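{- Let $\pi\in\mathfrak{S}_n$ be an indecomposable permutation with exactly one descent, written $\pi=\pi^{(1)}\pi^{(2)}$ with $\pi^{(1)},\pi^{(2)}$ increasing, the last letter of $\pi^{(1)}$ being $n$ and the first letter of $\pi^{(2)}$ being $1$; let $A_1,A_2$ be the sets of letters of $\pi^{(1)},\pi^{(2)}$. Let $s\in[n]$, let $j\in\{1,2\}$ be such that $s\in A_j$, and set $\bar j=3-j$. Let $T$ be a spanning tree of $G_\pi$ rooted at $s$. Then for every $k\ge0$, $T^{(2k)}\subseteq A_j$ and $T^{(2k+1)}\subseteq A_{\bar j}$.
   Context: $G_\pi$: permutation graph on $[n]$, $a<b$ adjacent iff $b$ appears before $a$ in $\pi$. $T^{(k)}$ is the set of vertices at distance $k$ from $s$ in $T$. -}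

module Defs where

open import Data.Nat using (ℕ; zero; suc; _≤_)
import Data.Nat as ℕ
open import Data.Fin using (Fin; toℕ)
import Data.Fin as F
open import Data.Fin.Permutation using (Permutation′; _⟨$⟩ʳ_; _⟨$⟩ˡ_)
open import Data.Product using (Σ; ∃; _×_; _,_)
open import Data.Sum using (_⊎_)
open import Data.List using (List; []; _∷_)
open import Data.List.Relation.Unary.Unique.Propositional using (Unique)
open import Relation.Binary.PropositionalEquality using (_≡_)
open import Relation.Nullary using (¬_)
open import Function.Bundles using (_⇔_)

-- Convention: π ∈ 𝔖_n is given in one-line notation, positions and letters
-- both 0-indexed as Fin n; the letter at position i is  π ⟨$⟩ʳ i .

pos : ∀ {n} → Permutation′ n → Fin n → Fin n
pos π a = π ⟨$⟩ˡ a

IsDescent : ∀ {n} → Permutation′ n → Fin n → Set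
IsDescent {n} π d = Σ (Fin n) λ e → (toℕ e ≡ suc (toℕ d)) × ((π ⟨$⟩ʳ e) F.< (π ⟨$⟩ʳ d))

Decomposable : ∀ {n} → Permutation′ n → Set
Decomposable {n} π = Σ ℕ λ k → (1 ≤ k) × (k ℕ.< n) ×
  (∀ (v : Fin n) → (toℕ v ℕ.< k) ⇔ (Σ (Fin n) λ i → (toℕ i ℕ.< k) × (π ⟨$⟩ʳ i ≡ v)))

Indecomposable : ∀ {n} → Permutation′ n → Set
Indecomposable π = ¬ Decomposable π

GEdge : ∀ {n} → Permutation′ n → Fin n → Fin n → Set
GEdge π a b = ((a F.< b) × (pos π b F.< pos π a)) ⊎ ((b F.< a) × (pos π a F.< pos π b))

-- Given the (unique) descent position d, π = π⁽¹⁾π⁽²⁾ with π⁽¹⁾ = positions ≤ d.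
-- A₁ / A₂ = sets of letters of π⁽¹⁾ / π⁽²⁾.
InA₁ : ∀ {n} → Permutation′ n → Fin n → Fin n → Set
InA₁ {n} π d v = Σ (Fin n) λ i → (toℕ i ≤ toℕ d) × (π ⟨$⟩ʳ i ≡ v)

InA₂ : ∀ {n} → Permutation′ n → Fin n → Fin n → Set
InA₂ {n} π d v = Σ (Fin n) λ i → (toℕ d ℕ.< toℕ i) × (π ⟨$⟩ʳ i ≡ v)

-- A_j for j ∈ {1,2}, encoded as Fin 2 (zero ↦ 1, suc zero ↦ 2)
InA : ∀ {n} → Permutation′ n → Fin n → Fin 2 → Fin n → Set
InA π d F.zero v = InA₁ π d v
InA π d (F.suc F.zero) v = InA₂ π d v

bar : Fin 2 → Fin 2
bar F.zero = F.suc F.zero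
bar (F.suc F.zero) = F.zero

Graph : ℕ → Set₁
Graph n = Fin n → Fin n → Set

data Walk {n} (E : Graph n) : Fin n → Fin n → ℕ → Set where
  nil  : ∀ {u} → Walk E u u 0
  cons : ∀ {u w v k} → E u w → Walk E w v k → Walk E u v (suc k)

walkVertices : ∀ {n} {E : Graph n} {u v k} → Walk E u v k → List (Fin n)
walkVertices {u = u} nil = u ∷ []
walkVertices {u = u} (cons _ p) = u ∷ walkVertices p

IsPath : ∀ {n} {E : Graph n} {u v k} → Walk E u v k → Set
IsPath p = Unique (walkVertices p)

HasCycle : ∀ {n} → Graph n → Set
HasCycle {n} E = Σ (Fin n) λ u → Σ (Fin n) λ v → Σ ℕ λ k →
  E u v × (2 ≤ k) × Σ (Walk E v u k) IsPath

Connected : ∀ {n} → Graph n → Set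
Connected {n} E = ∀ (u v : Fin n) → Σ ℕ λ k → Walk E u v k

IsSimpleGraph : ∀ {n} → Graph n → Set
IsSimpleGraph {n} E = (∀ (u v : Fin n) → E u v → E v u) × (∀ (u : Fin n) → ¬ E u u)

IsTree : ∀ {n} → Graph n → Set
IsTree E = IsSimpleGraph E × Connected E × ¬ HasCycle E

IsSpanningTreeOf : ∀ {n} → Graph n → Permutation′ n → Set
IsSpanningTreeOf {n} T π = IsTree T × (∀ (u v : Fin n) → T u v → GEdge π u v)

HasDist : ∀ {n} → Graph n → Fin n → Fin n → ℕ → Set
HasDist E s v k = Walk E s v k × (∀ m → Walk E s v m → k ≤ m)

InLevel : ∀ {n} → Graph n → Fin n → ℕ → Fin n → Set
InLevel T s k v = HasDist T s v k

-- The letters of each increasing block π⁽¹⁾, π⁽²⁾ contain no inversion, hence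
-- are independent in G_π: the unique descent makes G_π bipartite with parts A₁, A₂.
-- Every edge of T is an edge of G_π, so each step of a walk from s in T switches
-- part, and a vertex at distance k lies in A_j or A_j̄ according to the parity of k.
module Submission where

open import Defs
open import Data.Nat using (ℕ; zero; suc; _+_; _*_; _<_; s≤s)
open import Data.Nat.Properties
  using (<-cmp; <-asym; <-irrefl; <-trans; ≤-trans; ≤-refl; ≤-reflexive; <-≤-trans; ≤-<-trans; ≤-<-connex;
         n≤1+n; m≤n+m; +-suc; 1+n≢n; m≤n⇒∃[o]m+o≡n; +-comm)
open import Data.Fin using (Fin; toℕ; fromℕ<)
import Data.Fin as F
open import Data.Fin.Properties using (toℕ-fromℕ<; toℕ-injective; toℕ<n)
open import Data.Fin.Permutation using (Permutation′; _⟨$⟩ʳ_; _⟨$⟩ˡ_; inverseˡ; inverseʳ)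
open import Data.Product using (_×_; _,_)
open import Data.Sum using (_⊎_; inj₁; inj₂)
open import Data.Empty using (⊥-elim)
open import Relation.Nullary using (¬_)
open import Relation.Binary.Definitions using (tri<; tri≈; tri>)
open import Relation.Binary.PropositionalEquality using (_≡_; refl; sym; trans; cong; subst; subst₂)

module _ {n} (π : Permutation′ n) where

  ⟨$⟩ʳ-injective : ∀ {i i'} → π ⟨$⟩ʳ i ≡ π ⟨$⟩ʳ i' → i ≡ i'
  ⟨$⟩ʳ-injective eq = trans (sym (inverseˡ π)) (trans (cong (π ⟨$⟩ˡ_) eq) (inverseˡ π))

  ascent-at-non-descent : ∀ {i e} → toℕ e ≡ suc (toℕ i) → ¬ IsDescent π i →
                          π ⟨$⟩ʳ i F.< π ⟨$⟩ʳ e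
  ascent-at-non-descent {i} {e} e≡1+i ¬desc with <-cmp (toℕ (π ⟨$⟩ʳ i)) (toℕ (π ⟨$⟩ʳ e))
  ... | tri< πi<πe _ _ = πi<πe
  ... | tri≈ _ πi≡πe _ =
    ⊥-elim (1+n≢n (trans (sym e≡1+i) (cong toℕ (sym (⟨$⟩ʳ-injective (toℕ-injective πi≡πe))))))
  ... | tri> _ _ πe<πi = ⊥-elim (¬desc (e , e≡1+i , πe<πi))

  DescentFreeBetween : Fin n → Fin n → Set
  DescentFreeBetween i i' = ∀ p → i F.≤ p → p F.< i' → ¬ IsDescent π p

  private
    increasing-across-gap : ∀ m {i i'} → toℕ i' ≡ suc (m + toℕ i) →
      DescentFreeBetween i i' → π ⟨$⟩ʳ i F.< π ⟨$⟩ʳ i'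
    increasing-across-gap zero i'≡1+i free =
      ascent-at-non-descent i'≡1+i (free _ ≤-refl (≤-reflexive (sym i'≡1+i)))
    increasing-across-gap (suc m) {i} {i'} i'≡2+m+i free =
      <-trans (ascent-at-non-descent p≡1+i (free i ≤-refl i<i'))
              (increasing-across-gap m i'≡1+m+p
                 (λ q p≤q q<i' → free q (≤-trans (n≤1+n _) (≤-trans (≤-reflexive (sym p≡1+i)) p≤q)) q<i'))
      where
      i<i' : toℕ i < toℕ i'
      i<i' = ≤-trans (s≤s (m≤n+m (toℕ i) (suc m))) (≤-reflexive (sym i'≡2+m+i))
      1+i<n : suc (toℕ i) < n
      1+i<n = ≤-<-trans i<i' (toℕ<n i')
      p : Fin n
      p = fromℕ< 1+i<n
      p≡1+i : toℕ p ≡ suc (toℕ i)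
      p≡1+i = toℕ-fromℕ< 1+i<n
      i'≡1+m+p : toℕ i' ≡ suc (m + toℕ p)
      i'≡1+m+p = trans i'≡2+m+i (cong suc (trans (sym (+-suc m (toℕ i))) (cong (m +_) (sym p≡1+i))))

  increasing-on-descent-free-run : ∀ {i i'} → i F.< i' → DescentFreeBetween i i' →
                                   π ⟨$⟩ʳ i F.< π ⟨$⟩ʳ i'
  increasing-on-descent-free-run {i} i<i' with m≤n⇒∃[o]m+o≡n i<i'
  ... | m , 1+i+m≡i' = increasing-across-gap m (trans (sym 1+i+m≡i') (cong suc (+-comm (toℕ i) m)))

  IncreasingOn : (Fin n → Set) → Set
  IncreasingOn S = ∀ {i i'} → S i → S i' → i F.< i' → π ⟨$⟩ʳ i F.< π ⟨$⟩ʳ i'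

  increasing⇒no-edge : ∀ {S} → IncreasingOn S →
    ∀ {i i'} → S i → S i' → ¬ GEdge π (π ⟨$⟩ʳ i) (π ⟨$⟩ʳ i')
  increasing⇒no-edge incr Si Si' (inj₁ (πi<πi' , i'<i)) =
    <-asym πi<πi' (incr Si' Si (subst₂ F._<_ (inverseˡ π) (inverseˡ π) i'<i))
  increasing⇒no-edge incr Si Si' (inj₂ (πi'<πi , i<i')) =
    <-asym πi'<πi (incr Si Si' (subst₂ F._<_ (inverseˡ π) (inverseˡ π) i<i'))

module _ {n} (π : Permutation′ n) (d : Fin n)
         (unique-descent : ∀ (e : Fin n) → IsDescent π e → e ≡ d) where

  increasing-up-to-descent : IncreasingOn π (F._≤ d)
  increasing-up-to-descent _ i'≤d i<i' =
    increasing-on-descent-free-run π i<i'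
      (λ p _ p<i' desc → <-irrefl (cong toℕ (unique-descent p desc)) (<-≤-trans p<i' i'≤d))

  increasing-after-descent : IncreasingOn π (d F.<_)
  increasing-after-descent d<i _ i<i' =
    increasing-on-descent-free-run π i<i'
      (λ p i≤p _ desc → <-irrefl (cong toℕ (sym (unique-descent p desc))) (<-≤-trans d<i i≤p))

  InA₁⊎InA₂ : ∀ v → InA₁ π d v ⊎ InA₂ π d v
  InA₁⊎InA₂ v with ≤-<-connex (toℕ (pos π v)) (toℕ d)
  ... | inj₁ ≤d = inj₁ (pos π v , ≤d , inverseʳ π)
  ... | inj₂ d< = inj₂ (pos π v , d< , inverseʳ π)

  edge-switches-part : ∀ j {u w} → InA π d j u → GEdge π u w → InA π d (bar j) w
  edge-switches-part F.zero (i , i≤d , refl) uw with InA₁⊎InA₂ _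
  ... | inj₂ w∈A₂ = w∈A₂
  ... | inj₁ (i' , i'≤d , refl) = ⊥-elim (increasing⇒no-edge π increasing-up-to-descent i≤d i'≤d uw)
  edge-switches-part (F.suc F.zero) (i , d<i , refl) uw with InA₁⊎InA₂ _
  ... | inj₁ w∈A₁ = w∈A₁
  ... | inj₂ (i' , d<i' , refl) = ⊥-elim (increasing⇒no-edge π increasing-after-descent d<i d<i' uw)

bar^ : ℕ → Fin 2 → Fin 2
bar^ zero j = j
bar^ (suc k) j = bar^ k (bar j)

bar-involutive : ∀ j → bar (bar j) ≡ j
bar-involutive F.zero = refl
bar-involutive (F.suc F.zero) = refl

bar^-even : ∀ k j → bar^ (2 * k) j ≡ j
bar^-even zero j = refl
bar^-even (suc k) j rewrite +-suc k (k + 0) = trans (bar^-even k (bar (bar j))) (bar-involutive j)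

walk-alternates : ∀ {n} {E : Graph n} (C : Fin 2 → Fin n → Set) →
  (∀ j {u w} → C j u → E u w → C (bar j) w) →
  ∀ j {u v k} → C j u → Walk E u v k → C (bar^ k j) v
walk-alternates C switch j Cu nil = Cu
walk-alternates C switch j Cu (cons uw walk) = walk-alternates C switch (bar j) (switch j Cu uw) walk

lemma5p3 : ∀ {n} (π : Permutation′ n) → Indecomposable π →
    (d : Fin n) → IsDescent π d → (∀ (e : Fin n) → IsDescent π e → e ≡ d) →
    (s : Fin n) (j : Fin 2) → InA π d j s →
    (T : Graph n) → IsSpanningTreeOf T π →
    ∀ (k : ℕ) (v : Fin n) →
      (InLevel T s (2 * k) v → InA π d j v) × (InLevel T s (suc (2 * k)) v → InA π d (bar j) v)
lemma5p3 π _ d _ unique-descent s j s∈Aj T (_ , T⊆Gπ) k v =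
  (λ (walk , _) → subst (λ j' → InA π d j' v) (bar^-even k j) (along walk)) ,
  (λ (walk , _) → subst (λ j' → InA π d j' v) (bar^-even k (bar j)) (along walk))
  where
  along : ∀ {m} → Walk T s v m → InA π d (bar^ m j) v
  along = walk-alternates (InA π d)
            (λ j' u∈Aj' uw → edge-switches-part π d unique-descent j' u∈Aj' (T⊆Gπ _ _ uw)) j s∈Aj
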